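{- Let $n$ be an odd positive integer and let $(v_1,\ldots,v_n)$ be an $n$-dimensional icube in $\mathbb{Z}^n$. Then its edge length is an integer.
   Context: An icube in $\mathbb{Z}^n$ of dimension $k$ is a sequence $(v_1,\ldots,v_k)$ of $k$ nonzero vectors in $\mathbb{Z}^n$ that are pairwise orthogonal (standard dot product) and all have the same Euclidean length; this common length is the edge length of the icube. -}

module Defs where

open import Data.Nat using (ℕ; suc; _*_)
open import Data.Fin using (Fin)
open import Data.Integer using (ℤ; _+_; 0ℤ)
open import Data.Vec.Functional using (Vector; foldr; zipWith)
open import Relation.Binary.PropositionalEquality using (_≡_; refl)
open import Relation.Nullary using (¬_)
open import Data.Product using (_×_; ∃; _,_)
import Data.Fin as Fin
import Data.Integer as ℤ

ℤVec : ℕ → Set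
ℤVec n = Vector ℤ n

dot : ∀ {n} → ℤVec n → ℤVec n → ℤ
dot u v = foldr _+_ 0ℤ (zipWith ℤ._*_ u v)

IsZeroVec : ∀ {n} → ℤVec n → Set
IsZeroVec v = ∀ i → v i ≡ 0ℤ

record IsICube (n k : ℕ) (v : Fin k → ℤVec n) : Set where
  field
    nonzero    : ∀ i → ¬ IsZeroVec (v i)
    orthogonal : ∀ i j → ¬ i ≡ j → dot (v i) (v j) ≡ 0ℤ
    sameLength : ∀ i j → dot (v i) (v i) ≡ dot (v j) (v j)

-- the edge length of an icube is √(v₀·v₀) (v₀ any of its vectors; all have
-- the same length).  It is an integer iff the squared length is m*m for an
-- integer l.  (Dimension suc k ≥ 1, so the first vector exists.)
EdgeLengthIsInteger : ∀ {n k} → (v : Fin (suc k) → ℤVec n) → Set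
EdgeLengthIsInteger v = ∃ λ (l : ℤ) → l ℤ.* l ≡ dot (v Fin.zero) (v Fin.zero)

{-# OPTIONS --safe #-}
module Submission where

-- Let V be the matrix with rows vᵢ and let d = v₀ · v₀. Orthogonality and equal lengths say V Vᵀ = d I, so
-- det(V)² = det(V Vᵀ) = dⁿ = d (dᵐ)² for n = 2m + 1. If d ≠ 0, d is therefore the square of the rational
-- det(V) / dᵐ, and an integer that is the square of a rational is the square of an integer: after cancelling
-- the gcd, the denominator divides the square of a coprime numerator, so it is 1.
--
-- The determinant, defined by Laplace expansion along the first column, is the unique alternating
-- multilinear function of the rows with value 1 at the identity: expanding each row in the unit basis
-- reduces such a function to matrices whose rows are unit vectors, and those are sorted by transpositions.
-- Both det(A Bᵀ) = det A · det B and det Aᵀ = det A then follow from uniqueness.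

open import Defs
open import Data.Nat as ℕ using (ℕ; zero; suc)
import Data.Nat.Properties as ℕₚ
open import Data.Nat.Divisibility using (_∣_; divides; ∣-refl; 0∣⇒≡0)
open import Data.Nat.DivMod using (_/_; m/n*n≡m)
open import Data.Nat.GCD using (gcd; gcd[m,n]∣m; gcd[m,n]∣n)
open import Data.Nat.Coprimality using (Coprime; coprime-/gcd; coprime-divisor)
  renaming (sym to coprime-sym)
import Data.Nat.Tactic.RingSolver as ℕ-Solver
open import Data.Fin as Fin using (Fin; zero; suc; toℕ; inject₁; punchIn; punchOut; fromℕ)
import Data.Fin.Properties as Finₚ
open import Data.Fin.Induction using (<-weakInduction; >-weakInduction)
open import Data.Fin.Permutation.Components using () renaming (transpose to τ)
open import Data.Vec.Functional using (Vector; _∷_; tail; updateAt; zipWith; transpose)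
open import Data.Vec.Functional.Properties using (updateAt-updates; updateAt-minimal)
open import Data.Integer as ℤ using (ℤ; 0ℤ; 1ℤ; -1ℤ; _+_; _*_; -_; _^_)
import Data.Integer.Properties as ℤₚ
open import Data.Integer.Tactic.RingSolver using (solve-∀)
open import Algebra.Properties.Semiring.Sum ℤₚ.+-*-semiring
  using (sum; sum-cong-≗; ∑-distrib-+; *-distribˡ-sum; sum-replicate-zero)
open import Algebra.Properties.Monoid.Sum ℤₚ.*-1-monoid using ()
  renaming (sum to product; sum-replicate-zero to product-replicate-one)
open import Data.Product using (∃; ∃₂; _×_; _,_)
open import Data.Sum using (_⊎_; inj₁; inj₂)
open import Function using (_∘_; const)
open import Relation.Nullary using (yes; no; contradiction)
open import Relation.Binary.Definitions using (Tri; tri<; tri≈; tri>)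
open import Relation.Binary.PropositionalEquality
  using (_≡_; _≢_; _≗_; refl; sym; trans; cong; cong₂; cong-app; subst; module ≡-Reasoning)
open ≡-Reasoning

private variable
  k n : ℕ

sum-zero : ∀ (f : Fin n → ℤ) → (∀ i → f i ≡ 0ℤ) → sum f ≡ 0ℤ
sum-zero {n} f f≗0 = trans (sum-cong-≗ f≗0) (sum-replicate-zero n)

sum-linear : ∀ a b (f g : Fin n → ℤ) → a * sum f + b * sum g ≡ sum (λ i → a * f i + b * g i)
sum-linear a b f g = begin
  a * sum f + b * sum g                      ≡⟨ cong₂ _+_ (*-distribˡ-sum a f) (*-distribˡ-sum b g) ⟩
  sum (λ i → a * f i) + sum (λ i → b * g i)  ≡⟨ ∑-distrib-+ (λ i → a * f i) (λ i → b * g i) ⟨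
  sum (λ i → a * f i + b * g i)              ∎

self-negative⇒zero : ∀ {x} → x ≡ - x → x ≡ 0ℤ
self-negative⇒zero {x} x≡-x = ℤₚ.*-cancelˡ-≡ (ℤ.+ 2) x 0ℤ (begin
  ℤ.+ 2 * x   ≡⟨ double x ⟩
  x + x       ≡⟨ cong (x +_) x≡-x ⟩
  x + - x     ≡⟨ ℤₚ.+-inverseʳ x ⟩
  0ℤ          ∎)
  where
  double : ∀ x → ℤ.+ 2 * x ≡ x + x
  double = solve-∀

dot-linearˡ : ∀ {u x y : ℤVec n} a b w → (∀ j → u j ≡ a * x j + b * y j) →
              dot u w ≡ a * dot x w + b * dot y w
dot-linearˡ {u = u} {x} {y} a b w u≗ax+by = begin
  sum (λ j → u j * w j)
    ≡⟨ sum-cong-≗ (λ j → distrib (u≗ax+by j)) ⟩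
  sum (λ j → a * (x j * w j) + b * (y j * w j))
    ≡⟨ sum-linear a b (λ j → x j * w j) (λ j → y j * w j) ⟨
  a * dot x w + b * dot y w
    ∎
  where
  distrib : ∀ {j} → u j ≡ a * x j + b * y j → u j * w j ≡ a * (x j * w j) + b * (y j * w j)
  distrib {j} eq = trans (cong (_* w j) eq) (lemma a b (x j) (y j) (w j))
    where
    lemma : ∀ a b x y w → (a * x + b * y) * w ≡ a * (x * w) + b * (y * w)
    lemma = solve-∀

δ : Fin n → Fin n → ℤ
δ zero    zero    = 1ℤ
δ zero    (suc _) = 0ℤ
δ (suc _) zero    = 0ℤ
δ (suc i) (suc j) = δ i j

δ-sym : ∀ (i j : Fin n) → δ i j ≡ δ j i
δ-sym zero    zero    = refl
δ-sym zero    (suc _) = refl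
δ-sym (suc _) zero    = refl
δ-sym (suc i) (suc j) = δ-sym i j

δ-diag : ∀ (i : Fin n) → δ i i ≡ 1ℤ
δ-diag zero    = refl
δ-diag (suc i) = δ-diag i

δ-offdiag : ∀ {i j : Fin n} → i ≢ j → δ i j ≡ 0ℤ
δ-offdiag {i = zero}  {zero}  i≢j = contradiction refl i≢j
δ-offdiag {i = zero}  {suc _} _   = refl
δ-offdiag {i = suc _} {zero}  _   = refl
δ-offdiag {i = suc i} {suc j} i≢j = δ-offdiag (i≢j ∘ cong suc)

dot-δˡ : ∀ (i : Fin n) (x : ℤVec n) → dot (δ i) x ≡ x i
dot-δˡ zero x = begin
  1ℤ * x zero + sum (λ c → 0ℤ * x (suc c))
    ≡⟨ cong₂ _+_ (ℤₚ.*-identityˡ (x zero)) (sum-zero (λ c → 0ℤ * x (suc c)) (λ _ → refl)) ⟩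
  x zero + 0ℤ
    ≡⟨ ℤₚ.+-identityʳ (x zero) ⟩
  x zero
    ∎
dot-δˡ (suc i) x = trans (ℤₚ.+-identityˡ _) (dot-δˡ i (tail x))

sum-on-pair : ∀ (f : Fin n → ℤ) {p q} → p ≢ q → (∀ i → i ≢ p → i ≢ q → f i ≡ 0ℤ) →
              sum f ≡ f p + f q
sum-on-pair f {p} {q} p≢q vanishes = begin
  sum f                                  ≡⟨ sum-cong-≗ split ⟩
  sum (λ i → f p * δ p i + f q * δ q i)  ≡⟨ sum-linear (f p) (f q) (δ p) (δ q) ⟨
  f p * sum (δ p) + f q * sum (δ q)      ≡⟨ cong₂ (λ x y → f p * x + f q * y) (sum-δ p) (sum-δ q) ⟩
  f p * 1ℤ + f q * 1ℤ                    ≡⟨ cong₂ _+_ (ℤₚ.*-identityʳ (f p)) (ℤₚ.*-identityʳ (f q)) ⟩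
  f p + f q                              ∎
  where
  sum-δ : ∀ i → sum (δ i) ≡ 1ℤ
  sum-δ i = trans (sum-cong-≗ (λ j → sym (ℤₚ.*-identityʳ (δ i j)))) (dot-δˡ i (λ _ → 1ℤ))
  split : ∀ i → f i ≡ f p * δ p i + f q * δ q i
  split i with i Finₚ.≟ p | i Finₚ.≟ q
  ... | yes refl | yes refl = contradiction refl p≢q
  ... | yes refl | no i≢q   =
    sym (trans (cong₂ (λ x y → f i * x + f q * y) (δ-diag i) (δ-offdiag (i≢q ∘ sym))) (first (f i) (f q)))
    where
    first : ∀ x y → x * 1ℤ + y * 0ℤ ≡ x
    first = solve-∀
  ... | no i≢p   | yes refl =
    sym (trans (cong₂ (λ x y → f p * x + f i * y) (δ-offdiag (i≢p ∘ sym)) (δ-diag i)) (second (f p) (f i)))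
    where
    second : ∀ x y → x * 0ℤ + y * 1ℤ ≡ y
    second = solve-∀
  ... | no i≢p   | no i≢q   = trans (vanishes i i≢p i≢q)
    (sym (trans (cong₂ (λ x y → f p * x + f q * y) (δ-offdiag (i≢p ∘ sym)) (δ-offdiag (i≢q ∘ sym)))
                (neither (f p) (f q))))
    where
    neither : ∀ x y → x * 0ℤ + y * 0ℤ ≡ 0ℤ
    neither = solve-∀

inject₁≢suc : ∀ (i : Fin n) → inject₁ i ≢ suc i
inject₁≢suc i = Finₚ.<⇒≢ (Finₚ.≤̄⇒inject₁< (Finₚ.≤-refl {x = i}))

transpose-matchˡ : ∀ (p q : Fin n) → τ p q p ≡ q
transpose-matchˡ p q with p Finₚ.≟ p
... | yes _   = refl
... | no p≢p  = contradiction refl p≢p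

transpose-matchʳ : ∀ (p q : Fin n) → τ p q q ≡ p
transpose-matchʳ p q with q Finₚ.≟ p
... | yes q≡p = q≡p
... | no _ with q Finₚ.≟ q
...   | yes _   = refl
...   | no q≢q  = contradiction refl q≢q

transpose-mismatch : ∀ {p q i : Fin n} → i ≢ p → i ≢ q → τ p q i ≡ i
transpose-mismatch {p = p} {q} {i} i≢p i≢q with i Finₚ.≟ p
... | yes i≡p = contradiction i≡p i≢p
... | no _ with i Finₚ.≟ q
...   | yes i≡q = contradiction i≡q i≢q
...   | no _    = refl

pair-cases : ∀ (p q i : Fin n) → i ≡ p ⊎ i ≡ q ⊎ (i ≢ p × i ≢ q)
pair-cases p q i with i Finₚ.≟ p | i Finₚ.≟ q
... | yes i≡p | _       = inj₁ i≡p
... | no _    | yes i≡q = inj₂ (inj₁ i≡q)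
... | no i≢p  | no i≢q  = inj₂ (inj₂ (i≢p , i≢q))

transpose-involutive : ∀ (p q i : Fin n) → τ p q (τ p q i) ≡ i
transpose-involutive p q i with pair-cases p q i
... | inj₁ refl               = trans (cong (τ i q) (transpose-matchˡ i q)) (transpose-matchʳ i q)
... | inj₂ (inj₁ refl)        = trans (cong (τ p i) (transpose-matchʳ p i)) (transpose-matchˡ p i)
... | inj₂ (inj₂ (i≢p , i≢q)) =
  trans (cong (τ p q) (transpose-mismatch i≢p i≢q)) (transpose-mismatch i≢p i≢q)

transpose-invariance : ∀ {X : Set} (f : Fin n → X) {p q} → f p ≡ f q → ∀ j → f (τ p q j) ≡ f j
transpose-invariance f {p} {q} fp≡fq j with pair-cases p q j
... | inj₁ refl               = trans (cong f (transpose-matchˡ p q)) (sym fp≡fq)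
... | inj₂ (inj₁ refl)        = trans (cong f (transpose-matchʳ p q)) fp≡fq
... | inj₂ (inj₂ (j≢p , j≢q)) = cong f (transpose-mismatch j≢p j≢q)

δ-transpose : ∀ (p q i j : Fin n) → δ i (τ p q j) ≡ δ (τ p q i) j
δ-transpose p q i j with i Finₚ.≟ τ p q j
... | yes refl =
  trans (δ-diag (τ p q j)) (sym (trans (cong (λ r → δ r j) (transpose-involutive p q j)) (δ-diag j)))
... | no i≢τj  = trans (δ-offdiag i≢τj) (sym (δ-offdiag τi≢j))
  where
  τi≢j : τ p q i ≢ j
  τi≢j τi≡j = i≢τj (trans (sym (transpose-involutive p q i)) (cong (τ p q) τi≡j))

Matrix : ℕ → ℕ → Set
Matrix k n = Vector (ℤVec n) k

infix 4 _≈_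

_≈_ : Matrix k n → Matrix k n → Set
A ≈ B = ∀ i → A i ≗ B i

1ᴹ : Matrix n n
1ᴹ = δ

AgreeOffRow : Fin k → Matrix k n → Matrix k n → Set
AgreeOffRow p A B = ∀ i → i ≢ p → A i ≗ B i

RowLinear : (Matrix k n → ℤ) → Set
RowLinear {k} {n} F = ∀ p a b (A B C : Matrix k n) → AgreeOffRow p A B → AgreeOffRow p A C →
  (∀ j → A p j ≡ a * B p j + b * C p j) → F A ≡ a * F B + b * F C

Alternating : (Matrix k n → ℤ) → Set
Alternating {k} {n} F = ∀ (A : Matrix k n) p q → p ≢ q → A p ≗ A q → F A ≡ 0ℤ

record IsMultilinear {k n} (F : Matrix k n → ℤ) : Set where
  field
    cong-≈ : ∀ {A B} → A ≈ B → F A ≡ F B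
    linear : RowLinear F

antisymmetric-if-alternating : ∀ {X : Set} (_⊕_ : X → X → X) (G : X → X → ℤ) →
  (∀ x y z → G (x ⊕ y) z ≡ G x z + G y z) → (∀ x y z → G x (y ⊕ z) ≡ G x y + G x z) →
  (∀ x → G x x ≡ 0ℤ) → ∀ x y → G y x ≡ - G x y
antisymmetric-if-alternating _⊕_ G additiveˡ additiveʳ alternating x y = begin
  G y x                                              ≡⟨ solve-lemma (G x y) (G y x) ⟨
  (0ℤ + G x y) + (G y x + 0ℤ) + - G x y              ≡⟨ cong (_+ - G x y) expand-diagonal ⟨
  G (x ⊕ y) (x ⊕ y) + - G x y                        ≡⟨ cong (_+ - G x y) (alternating (x ⊕ y)) ⟩
  0ℤ + - G x y                                       ≡⟨ ℤₚ.+-identityˡ (- G x y) ⟩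
  - G x y                                            ∎
  where
  solve-lemma : ∀ a b → (0ℤ + a) + (b + 0ℤ) + - a ≡ b
  solve-lemma = solve-∀
  expand-diagonal : G (x ⊕ y) (x ⊕ y) ≡ (0ℤ + G x y) + (G y x + 0ℤ)
  expand-diagonal = begin
    G (x ⊕ y) (x ⊕ y)                  ≡⟨ additiveˡ x y (x ⊕ y) ⟩
    G x (x ⊕ y) + G y (x ⊕ y)          ≡⟨ cong₂ _+_ (additiveʳ x x y) (additiveʳ y x y) ⟩
    (G x x + G x y) + (G y x + G y y)  ≡⟨ cong₂ (λ u v → (u + G x y) + (G y x + v)) (alternating x) (alternating y) ⟩
    (0ℤ + G x y) + (G y x + 0ℤ)        ∎

module ReplaceRows {k n} (p q : Fin k) (A : Matrix k n) where

  replaceRows : ℤVec n → ℤVec n → Matrix k n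
  replaceRows x y = updateAt (updateAt A p (const x)) q (const y)

  replaceRows-q : ∀ {x y} → replaceRows x y q ≡ y
  replaceRows-q = updateAt-updates q _

  replaceRows-p : ∀ {x y} → p ≢ q → replaceRows x y p ≡ x
  replaceRows-p p≢q = trans (updateAt-minimal p q _ p≢q) (updateAt-updates p A)

  replaceRows-other : ∀ {x y i} → i ≢ p → i ≢ q → replaceRows x y i ≡ A i
  replaceRows-other i≢p i≢q = trans (updateAt-minimal _ q _ i≢q) (updateAt-minimal _ p A i≢p)

  replaceRows-agreeOffᵖ : ∀ {x y} x′ → AgreeOffRow p (replaceRows x y) (replaceRows x′ y)
  replaceRows-agreeOffᵖ {x} {y} x′ i i≢p with i Finₚ.≟ q
  ... | yes refl = cong-app (trans (replaceRows-q {x}) (sym replaceRows-q))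
  ... | no i≢q   = cong-app (trans (replaceRows-other {x} {y} i≢p i≢q) (sym (replaceRows-other i≢p i≢q)))

  replaceRows-agreeOffᵠ : ∀ {x y} y′ → AgreeOffRow q (replaceRows x y) (replaceRows x y′)
  replaceRows-agreeOffᵠ y′ i i≢q =
    cong-app (trans (updateAt-minimal i q _ i≢q) (sym (updateAt-minimal i q _ i≢q)))

module _ {F : Matrix k n → ℤ} (F-multilinear : IsMultilinear F) where
  open IsMultilinear F-multilinear

  additive : ∀ p (A B C : Matrix k n) → AgreeOffRow p A B → AgreeOffRow p A C →
             (∀ j → A p j ≡ B p j + C p j) → F A ≡ F B + F C
  additive p A B C A~B A~C Ap = trans
    (linear p 1ℤ 1ℤ A B C A~B A~C λ j → trans (Ap j) (sym (unit-sum (B p j) (C p j))))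
    (unit-sum (F B) (F C))
    where
    unit-sum : ∀ a b → 1ℤ * a + 1ℤ * b ≡ a + b
    unit-sum a b = cong₂ _+_ (ℤₚ.*-identityˡ a) (ℤₚ.*-identityˡ b)

  swapRows-negates : ∀ {p q} → p ≢ q → (∀ A → A p ≗ A q → F A ≡ 0ℤ) →
                     ∀ A → F (A ∘ τ p q) ≡ - F A
  swapRows-negates {p} {q} p≢q F-vanishes A = begin
    F (A ∘ τ p q)    ≡⟨ cong-≈ (characterise (A ∘ τ p q) (cong A (transpose-matchˡ p q))
                                 (cong A (transpose-matchʳ p q)) (λ i≢p i≢q → cong A (transpose-mismatch i≢p i≢q))) ⟩
    G (A q) (A p)    ≡⟨ antisymmetric-if-alternating _⊕_ G additiveˡ additiveʳ G-diagonal (A p) (A q) ⟩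
    - G (A p) (A q)  ≡⟨ cong -_ (cong-≈ (characterise A refl refl (λ _ _ → refl))) ⟨
    - F A            ∎
    where
    open ReplaceRows p q A

    G : ℤVec n → ℤVec n → ℤ
    G x y = F (replaceRows x y)

    _⊕_ : ℤVec n → ℤVec n → ℤVec n
    _⊕_ = zipWith _+_

    characterise : ∀ {x y} N → N p ≡ x → N q ≡ y → (∀ {i} → i ≢ p → i ≢ q → N i ≡ A i) →
                   N ≈ replaceRows x y
    characterise N Np Nq Ni i with pair-cases p q i
    ... | inj₁ refl               = cong-app (trans Np (sym (replaceRows-p p≢q)))
    ... | inj₂ (inj₁ refl)        = cong-app (trans Nq (sym replaceRows-q))
    ... | inj₂ (inj₂ (i≢p , i≢q)) = cong-app (trans (Ni i≢p i≢q) (sym (replaceRows-other i≢p i≢q)))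

    additiveˡ : ∀ x y z → G (x ⊕ y) z ≡ G x z + G y z
    additiveˡ x y z = additive p (replaceRows (x ⊕ y) z) (replaceRows x z) (replaceRows y z)
      (replaceRows-agreeOffᵖ x) (replaceRows-agreeOffᵖ y)
      (λ j → trans (cong-app (replaceRows-p p≢q) j)
                   (sym (cong₂ _+_ (cong-app (replaceRows-p p≢q) j) (cong-app (replaceRows-p p≢q) j))))

    additiveʳ : ∀ x y z → G x (y ⊕ z) ≡ G x y + G x z
    additiveʳ x y z = additive q (replaceRows x (y ⊕ z)) (replaceRows x y) (replaceRows x z)
      (replaceRows-agreeOffᵠ y) (replaceRows-agreeOffᵠ z)
      (λ j → trans (cong-app replaceRows-q j)
                   (sym (cong₂ _+_ (cong-app replaceRows-q j) (cong-app replaceRows-q j))))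

    G-diagonal : ∀ x → G x x ≡ 0ℤ
    G-diagonal x = F-vanishes _ (cong-app (trans (replaceRows-p p≢q) (sym replaceRows-q)))

alternating-if-adjacent : ∀ {F : Matrix (suc k) n → ℤ} → IsMultilinear F →
  (∀ A (p : Fin k) → A (inject₁ p) ≗ A (suc p) → F A ≡ 0ℤ) → Alternating F
alternating-if-adjacent {k} {n} {F} F-multilinear F-adjacent A p q p≢q Ap≗Aq = by-order (Finₚ.<-cmp p q)
  where
  VanishesAt : Fin (suc k) → Fin (suc k) → Set
  VanishesAt p q = p Fin.< q → ∀ A → A p ≗ A q → F A ≡ 0ℤ

  step : ∀ p j → VanishesAt p (inject₁ j) → VanishesAt p (suc j)
  step p j IH p<sj A Ap≗Asj with p Finₚ.≟ inject₁ j
  ... | yes refl = F-adjacent A j Ap≗Asj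
  ... | no p≢j   = ℤₚ.neg-injective (trans
    (sym (swapRows-negates F-multilinear (inject₁≢suc j) (λ B → F-adjacent B j) A))
    (IH p<j (A ∘ τ (inject₁ j) (suc j)) swapped))
    where
    p<j : p Fin.< inject₁ j
    p<j = Finₚ.≤∧≢⇒< (subst (toℕ p ℕ.≤_) (sym (Finₚ.toℕ-inject₁ j)) (ℕₚ.≤-pred p<sj)) p≢j
    swapped : A (τ (inject₁ j) (suc j) p) ≗ A (τ (inject₁ j) (suc j) (inject₁ j))
    swapped c = trans (cong (λ r → A r c) (transpose-mismatch p≢j (Finₚ.<⇒≢ p<sj)))
                      (trans (Ap≗Asj c) (cong (λ r → A r c) (sym (transpose-matchˡ (inject₁ j) (suc j)))))

  vanishes-above : ∀ p q → VanishesAt p q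
  vanishes-above p = <-weakInduction (VanishesAt p) (λ ()) (step p)

  by-order : Tri (p Fin.< q) (p ≡ q) (q Fin.< p) → F A ≡ 0ℤ
  by-order (tri< p<q _ _) = vanishes-above p q p<q A Ap≗Aq
  by-order (tri≈ _ p≡q _) = contradiction p≡q p≢q
  by-order (tri> _ _ q<p) = vanishes-above q p q<p A (sym ∘ Ap≗Aq)

sumMaps : ((Fin k → Fin n) → ℤ) → ℤ
sumMaps {zero}  h = h (λ ())
sumMaps {suc k} h = sum λ c → sumMaps λ g → h (c ∷ g)

sumMaps-cong : ∀ {h h′ : (Fin k → Fin n) → ℤ} → (∀ g → h g ≡ h′ g) → sumMaps h ≡ sumMaps h′
sumMaps-cong {zero}  h≗h′ = h≗h′ (λ ())
sumMaps-cong {suc k} h≗h′ = sum-cong-≗ λ c → sumMaps-cong λ g → h≗h′ (c ∷ g)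

*-distribˡ-sumMaps : ∀ a (h : (Fin k → Fin n) → ℤ) → a * sumMaps h ≡ sumMaps (λ g → a * h g)
*-distribˡ-sumMaps {zero}  a h = refl
*-distribˡ-sumMaps {suc k} a h =
  trans (*-distribˡ-sum a (λ c → sumMaps λ g → h (c ∷ g)))
        (sum-cong-≗ λ c → *-distribˡ-sumMaps a λ g → h (c ∷ g))

*-distribʳ-sumMaps : ∀ a (h : (Fin k → Fin n) → ℤ) → sumMaps h * a ≡ sumMaps (λ g → h g * a)
*-distribʳ-sumMaps a h = trans (ℤₚ.*-comm (sumMaps h) a)
  (trans (*-distribˡ-sumMaps a h) (sumMaps-cong λ g → ℤₚ.*-comm a (h g)))

unitRows : (Fin k → Fin n) → Matrix k n
unitRows g i = δ (g i)

entryProduct : Matrix k n → (Fin k → Fin n) → ℤ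
entryProduct A g = product λ i → A i (g i)

module _ {F : Matrix (suc k) n → ℤ} (F-multilinear : IsMultilinear F) where
  open IsMultilinear F-multilinear

  private
    off-head : ∀ {x y : ℤVec n} {B C : Matrix k n} → B ≈ C → AgreeOffRow zero (x ∷ B) (y ∷ C)
    off-head B≈C zero    0≢0 = contradiction refl 0≢0
    off-head B≈C (suc i) _   = B≈C i

  fixHead-multilinear : ∀ r → IsMultilinear (λ B → F (r ∷ B))
  fixHead-multilinear r = record
    { cong-≈ = λ B≈C → cong-≈ λ { zero _ → refl ; (suc i) → B≈C i }
    ; linear = λ p a b A B C A~B A~C Ap → linear (suc p) a b _ _ _
        (λ { zero _ _ → refl ; (suc i) i≢p → A~B i (i≢p ∘ cong suc) })
        (λ { zero _ _ → refl ; (suc i) i≢p → A~C i (i≢p ∘ cong suc) })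
        Ap
    }

  linear-∑-head : ∀ {m} (a : Fin m → ℤ) (v : Fin m → ℤVec n) B →
    F ((λ j → sum λ c → a c * v c j) ∷ B) ≡ sum λ c → a c * F (v c ∷ B)
  linear-∑-head {zero} a v B = linear zero 0ℤ 0ℤ (const 0ℤ ∷ B) (const 0ℤ ∷ B) (const 0ℤ ∷ B)
    (off-head (λ _ _ → refl)) (off-head (λ _ _ → refl)) (λ _ → refl)
  linear-∑-head {suc m} a v B = trans
    (linear zero (a zero) 1ℤ ((λ j → sum λ c → a c * v c j) ∷ B) (v zero ∷ B)
      ((λ j → sum λ c → a (suc c) * v (suc c) j) ∷ B)
      (off-head (λ _ _ → refl)) (off-head (λ _ _ → refl))
      (λ j → cong (a zero * v zero j +_) (sym (ℤₚ.*-identityˡ _))))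
    (cong (a zero * F (v zero ∷ B) +_) (trans (ℤₚ.*-identityˡ _) (linear-∑-head (a ∘ suc) (v ∘ suc) B)))

  expand-head : ∀ (x : ℤVec n) B → F (x ∷ B) ≡ sum λ c → x c * F (δ c ∷ B)
  expand-head x B = trans (cong-≈ x-as-combination) (linear-∑-head x δ B)
    where
    x-as-combination : (x ∷ B) ≈ ((λ j → sum λ c → x c * δ c j) ∷ B)
    x-as-combination zero    j = sym (trans
      (sum-cong-≗ λ c → trans (ℤₚ.*-comm (x c) (δ c j)) (cong (_* x c) (δ-sym c j))) (dot-δˡ j x))
    x-as-combination (suc i) j = refl

multilinear-expansion : ∀ {F : Matrix k n → ℤ} → IsMultilinear F →
  ∀ A → F A ≡ sumMaps λ g → entryProduct A g * F (unitRows g)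
multilinear-expansion {zero} F-multilinear A =
  trans (IsMultilinear.cong-≈ F-multilinear (λ ())) (sym (ℤₚ.*-identityˡ _))
multilinear-expansion {suc k} {n} {F} F-multilinear A = begin
  F A                                                          ≡⟨ cong-≈ head∷tail ⟩
  F (A zero ∷ tail A)                                          ≡⟨ expand-head F-multilinear (A zero) (tail A) ⟩
  sum (λ c → A zero c * F (δ c ∷ tail A))                      ≡⟨ sum-cong-≗ expand-rest ⟩
  sum (λ c → sumMaps λ g → entryProduct A (c ∷ g) * F (unitRows (c ∷ g)))  ∎
  where
  open IsMultilinear F-multilinear

  head∷tail : ∀ {B : Matrix (suc k) n} → B ≈ (B zero ∷ tail B)
  head∷tail zero    _ = refl
  head∷tail (suc i) _ = refl

  expand-rest : ∀ c → A zero c * F (δ c ∷ tail A) ≡ sumMaps λ g → entryProduct A (c ∷ g) * F (unitRows (c ∷ g))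
  expand-rest c = begin
    A zero c * F (δ c ∷ tail A)
      ≡⟨ cong (A zero c *_) (multilinear-expansion (fixHead-multilinear F-multilinear (δ c)) (tail A)) ⟩
    A zero c * sumMaps h                                            ≡⟨ *-distribˡ-sumMaps (A zero c) h ⟩
    sumMaps (λ g → A zero c * h g)                                  ≡⟨ sumMaps-cong regroup ⟩
    sumMaps (λ g → entryProduct A (c ∷ g) * F (unitRows (c ∷ g)))  ∎
    where
    h : (Fin k → Fin n) → ℤ
    h g = entryProduct (tail A) g * F (δ c ∷ unitRows g)

    regroup : ∀ g → A zero c * h g ≡ entryProduct A (c ∷ g) * F (unitRows (c ∷ g))
    regroup g = trans (sym (ℤₚ.*-assoc (A zero c) (entryProduct (tail A) g) _))
                      (cong (entryProduct A (c ∷ g) *_) (sym (cong-≈ head∷tail)))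

minor : Fin (suc n) → Matrix (suc n) (suc n) → Matrix n n
minor i A r c = A (punchIn i r) (suc c)

det : Matrix n n → ℤ
det {zero}  A = 1ℤ
det {suc n} A = sum λ i → -1ℤ ^ toℕ i * (A i zero * det (minor i A))

det-cong : ∀ {A B : Matrix n n} → A ≈ B → det A ≡ det B
det-cong {zero}  A≈B = refl
det-cong {suc n} A≈B = sum-cong-≗ λ i →
  cong₂ (λ x y → -1ℤ ^ toℕ i * (x * y)) (A≈B i zero) (det-cong λ r c → A≈B (punchIn i r) (suc c))

minor-agreeOff-self : ∀ {i} {A B : Matrix (suc n) (suc n)} → AgreeOffRow i A B → minor i A ≈ minor i B
minor-agreeOff-self {i = i} A~B r c = A~B (punchIn i r) (Finₚ.punchInᵢ≢i i r) (suc c)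

minor-agreeOff : ∀ {i p} (i≢p : i ≢ p) {A B : Matrix (suc n) (suc n)} →
                 AgreeOffRow p A B → AgreeOffRow (punchOut i≢p) (minor i A) (minor i B)
minor-agreeOff {i = i} i≢p A~B r r≢p c = A~B (punchIn i r) punchIn≢p (suc c)
  where
  punchIn≢p : punchIn i r ≢ _
  punchIn≢p eq = r≢p (Finₚ.punchIn-injective i r _ (trans eq (sym (Finₚ.punchIn-punchOut i≢p))))

minor-row : ∀ {i p} (i≢p : i ≢ p) (A : Matrix (suc n) (suc n)) → minor i A (punchOut i≢p) ≗ tail (A p)
minor-row i≢p A c = cong (λ r → A r (suc c)) (Finₚ.punchIn-punchOut i≢p)

private
  term-linear-entry : ∀ s a b x y z w u v → x ≡ a * y + b * z → w ≡ u → w ≡ v →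
                      s * (x * w) ≡ a * (s * (y * u)) + b * (s * (z * v))
  term-linear-entry s a b _ y z w _ _ refl refl refl = lemma s a b y z w
    where
    lemma : ∀ s a b y z w → s * ((a * y + b * z) * w) ≡ a * (s * (y * w)) + b * (s * (z * w))
    lemma = solve-∀

  term-linear-minor : ∀ s a b x y z w u v → x ≡ y → x ≡ z → w ≡ a * u + b * v →
                      s * (x * w) ≡ a * (s * (y * u)) + b * (s * (z * v))
  term-linear-minor s a b x _ _ _ u v refl refl refl = lemma s a b x u v
    where
    lemma : ∀ s a b x u v → s * (x * (a * u + b * v)) ≡ a * (s * (x * u)) + b * (s * (x * v))
    lemma = solve-∀

det-linear : RowLinear (det {n})
det-linear {zero}  ()
det-linear {suc n} p a b A B C A~B A~C Ap =
  trans (sum-cong-≗ term) (sym (sum-linear a b (laplaceTerm B) (laplaceTerm C)))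
  where
  laplaceTerm : Matrix (suc n) (suc n) → Fin (suc n) → ℤ
  laplaceTerm M i = -1ℤ ^ toℕ i * (M i zero * det (minor i M))

  term : ∀ i → laplaceTerm A i ≡ a * laplaceTerm B i + b * laplaceTerm C i
  term i with i Finₚ.≟ p
  ... | yes refl = term-linear-entry (-1ℤ ^ toℕ i) a b (A i zero) (B i zero) (C i zero)
    (det (minor i A)) (det (minor i B)) (det (minor i C))
    (Ap zero) (det-cong (minor-agreeOff-self A~B)) (det-cong (minor-agreeOff-self A~C))
  ... | no i≢p   = term-linear-minor (-1ℤ ^ toℕ i) a b (A i zero) (B i zero) (C i zero)
    (det (minor i A)) (det (minor i B)) (det (minor i C))
    (A~B i i≢p zero) (A~C i i≢p zero)
    (det-linear (punchOut i≢p) a b (minor i A) (minor i B) (minor i C)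
      (minor-agreeOff i≢p A~B) (minor-agreeOff i≢p A~C)
      (λ c → trans (minor-row i≢p A c) (trans (Ap (suc c))
               (sym (cong₂ (λ x y → a * x + b * y) (minor-row i≢p B c) (minor-row i≢p C c))))))

det-linearᶜ : RowLinear (λ (A : Matrix n n) → det (transpose A))
det-linearᶜ {zero}  ()
det-linearᶜ {suc n} p a b A B C A~B A~C Ap =
  trans (sum-cong-≗ (term p A~B A~C Ap)) (sym (sum-linear a b (laplaceTermᵀ B) (laplaceTermᵀ C)))
  where
  laplaceTermᵀ : Matrix (suc n) (suc n) → Fin (suc n) → ℤ
  laplaceTermᵀ M i = -1ℤ ^ toℕ i * (M zero i * det (minor i (transpose M)))

  term : ∀ p → AgreeOffRow p A B → AgreeOffRow p A C → (∀ j → A p j ≡ a * B p j + b * C p j) →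
         ∀ i → laplaceTermᵀ A i ≡ a * laplaceTermᵀ B i + b * laplaceTermᵀ C i
  term zero A~B A~C Ap i = term-linear-entry (-1ℤ ^ toℕ i) a b (A zero i) (B zero i) (C zero i)
    (det (minor i (transpose A))) (det (minor i (transpose B))) (det (minor i (transpose C)))
    (Ap i) (det-cong λ r c → A~B (suc c) (λ ()) (punchIn i r)) (det-cong λ r c → A~C (suc c) (λ ()) (punchIn i r))
  term (suc p) A~B A~C Ap i = term-linear-minor (-1ℤ ^ toℕ i) a b (A zero i) (B zero i) (C zero i)
    (det (minor i (transpose A))) (det (minor i (transpose B))) (det (minor i (transpose C)))
    (A~B zero (λ ()) i) (A~C zero (λ ()) i)
    (det-linearᶜ p a b (λ c r → A (suc c) (punchIn i r)) (λ c r → B (suc c) (punchIn i r))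
      (λ c r → C (suc c) (punchIn i r))
      (λ c c≢p r → A~B (suc c) (c≢p ∘ Finₚ.suc-injective) (punchIn i r))
      (λ c c≢p r → A~C (suc c) (c≢p ∘ Finₚ.suc-injective) (punchIn i r))
      (λ r → Ap (punchIn i r)))

det-multilinear : IsMultilinear (det {n})
det-multilinear = record { cong-≈ = det-cong ; linear = det-linear }

punchIn-adjacent : ∀ {X : Set} (f : Fin (suc (suc n)) → X) (p : Fin (suc n)) → f (inject₁ p) ≡ f (suc p) →
                   ∀ r → f (punchIn (inject₁ p) r) ≡ f (punchIn (suc p) r)
punchIn-adjacent         f zero    fp≡fsp zero    = sym fp≡fsp
punchIn-adjacent         f zero    fp≡fsp (suc r) = refl
punchIn-adjacent         f (suc p) fp≡fsp zero    = refl
punchIn-adjacent {suc n} f (suc p) fp≡fsp (suc r) = punchIn-adjacent (f ∘ suc) p fp≡fsp r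

adjacent-punchIn-preimage : ∀ (i : Fin (suc (suc n))) (p : Fin (suc n)) → i ≢ inject₁ p → i ≢ suc p →
  ∃ λ (p′ : Fin n) → punchIn i (inject₁ p′) ≡ inject₁ p × punchIn i (suc p′) ≡ suc p
adjacent-punchIn-preimage         zero             zero    i≢p _    = contradiction refl i≢p
adjacent-punchIn-preimage         zero             (suc p) _   _    = p , refl , refl
adjacent-punchIn-preimage         (suc zero)       zero    _   i≢sp = contradiction refl i≢sp
adjacent-punchIn-preimage {suc n} (suc (suc i))    zero    _   _    = zero , refl , refl
adjacent-punchIn-preimage {suc n} (suc i)          (suc p) i≢p i≢sp
  with p′ , p′↦p , sp′↦sp ← adjacent-punchIn-preimage i p (i≢p ∘ cong suc) (i≢sp ∘ cong suc)
  = suc p′ , cong suc p′↦p , cong suc sp′↦sp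

det-adjacent : ∀ (A : Matrix (suc n) (suc n)) (p : Fin n) → A (inject₁ p) ≗ A (suc p) → det A ≡ 0ℤ
det-adjacent {zero}  A ()
det-adjacent {suc n} A p Ap≗Asp = trans (sum-on-pair laplaceTerm (inject₁≢suc p) vanishes) pair-cancels
  where
  laplaceTerm : Fin (suc (suc n)) → ℤ
  laplaceTerm i = -1ℤ ^ toℕ i * (A i zero * det (minor i A))

  vanishes : ∀ i → i ≢ inject₁ p → i ≢ suc p → laplaceTerm i ≡ 0ℤ
  vanishes i i≢p i≢sp with p′ , p′↦p , sp′↦sp ← adjacent-punchIn-preimage i p i≢p i≢sp =
    trans (cong (λ x → -1ℤ ^ toℕ i * (A i zero * x)) minor-vanishes)
          (trans (cong (-1ℤ ^ toℕ i *_) (ℤₚ.*-zeroʳ (A i zero))) (ℤₚ.*-zeroʳ (-1ℤ ^ toℕ i)))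
    where
    minor-vanishes : det (minor i A) ≡ 0ℤ
    minor-vanishes = det-adjacent (minor i A) p′ λ c →
      trans (cong (λ r → A r (suc c)) p′↦p) (trans (Ap≗Asp (suc c)) (cong (λ r → A r (suc c)) (sym sp′↦sp)))

  pair-cancels : laplaceTerm (inject₁ p) + laplaceTerm (suc p) ≡ 0ℤ
  pair-cancels = begin
    laplaceTerm (inject₁ p) + laplaceTerm (suc p)
      ≡⟨ cong (_+ laplaceTerm (suc p)) (cong₂ (λ e x → -1ℤ ^ e * x) (Finₚ.toℕ-inject₁ p)
                                               (cong₂ _*_ (Ap≗Asp zero) (det-cong minors-agree))) ⟩
    s * x + (-1ℤ * s) * x
      ≡⟨ cancel s x ⟩
    0ℤ  ∎
    where
    minors-agree : minor (inject₁ p) A ≈ minor (suc p) A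
    minors-agree r c = punchIn-adjacent (λ i → A i (suc c)) p (Ap≗Asp (suc c)) r
    s = -1ℤ ^ toℕ p
    x = A (suc p) zero * det (minor (suc p) A)
    cancel : ∀ s x → s * x + (-1ℤ * s) * x ≡ 0ℤ
    cancel = solve-∀

det-alternating : Alternating (det {n})
det-alternating {zero}  A ()
det-alternating {suc n} = alternating-if-adjacent det-multilinear det-adjacent

det-diagonal : ∀ (d : ℤVec n) → det (λ i j → d i * δ i j) ≡ product d
det-diagonal {zero}  d = refl
det-diagonal {suc n} d = begin
  1ℤ * ((d zero * 1ℤ) * det (λ i j → d (suc i) * δ i j)) + sum offDiagonal
    ≡⟨ cong₂ (λ x y → 1ℤ * ((d zero * 1ℤ) * x) + y)
             (det-diagonal (d ∘ suc)) (sum-zero offDiagonal offDiagonal-vanishes) ⟩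
  1ℤ * ((d zero * 1ℤ) * product (d ∘ suc)) + 0ℤ
    ≡⟨ simplify (d zero) (product (d ∘ suc)) ⟩
  d zero * product (d ∘ suc) ∎
  where
  offDiagonal : Fin n → ℤ
  offDiagonal i = -1ℤ ^ toℕ (suc i) * ((d (suc i) * 0ℤ) * det (minor (suc i) λ i j → d i * δ i j))
  offDiagonal-vanishes : ∀ i → offDiagonal i ≡ 0ℤ
  offDiagonal-vanishes i = trans (cong (λ x → -1ℤ ^ toℕ (suc i) * (x * det (minor (suc i) λ i j → d i * δ i j)))
                                       (ℤₚ.*-zeroʳ (d (suc i))))
                                 (ℤₚ.*-zeroʳ (-1ℤ ^ toℕ (suc i)))
  simplify : ∀ x y → 1ℤ * ((x * 1ℤ) * y) + 0ℤ ≡ x * y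
  simplify = solve-∀

det-1ᴹ : det (1ᴹ {n}) ≡ 1ℤ
det-1ᴹ {n} = trans (det-cong {n} λ i j → sym (ℤₚ.*-identityˡ (δ i j)))
                   (trans (det-diagonal {n} (const 1ℤ)) (product-replicate-one n))

missing-value-collision : ∀ (g : Fin n → Fin n) {i} → (∀ j → g j ≢ i) →
                          ∃₂ λ j₁ j₂ → j₁ ≢ j₂ × g j₁ ≡ g j₂
missing-value-collision {zero}  g {()}
missing-value-collision {suc n} g missing
  with j₁ , j₂ , j₁<j₂ , eq ← Finₚ.pigeonhole (ℕₚ.n<1+n n) (λ j → punchOut (missing j ∘ sym))
  = j₁ , j₂ , Finₚ.<⇒≢ j₁<j₂ , Finₚ.punchOut-injective (missing j₁ ∘ sym) (missing j₂ ∘ sym) eq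

module _ {D : Matrix n n → ℤ} (D-multilinear : IsMultilinear D) (D-alternating : Alternating D) where
  open IsMultilinear D-multilinear

  -- FixedBelow b is proved for b = n, n - 1, …, 0. To fix position i, a transposition bringing the value i
  -- there negates both sides of the claim; if g misses the value i it repeats a value, and both sides vanish.
  private
    Claim : (Fin n → Fin n) → Set
    Claim g = D (unitRows g) ≡ det (unitRows g) * D 1ᴹ

    FixedBelow : Fin (suc n) → Set
    FixedBelow b = ∀ g → (∀ j → toℕ j ℕ.< toℕ b → g j ≡ j) → Claim g

    identity-case : ∀ g → (∀ j → g j ≡ j) → Claim g
    identity-case g g≗id = begin
      D (unitRows g)           ≡⟨ cong-≈ unitRows≈1ᴹ ⟩
      D 1ᴹ                     ≡⟨ ℤₚ.*-identityˡ (D 1ᴹ) ⟨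
      1ℤ * D 1ᴹ                ≡⟨ cong (_* D 1ᴹ) (trans (sym (det-1ᴹ {n})) (det-cong λ i j → sym (unitRows≈1ᴹ i j))) ⟩
      det (unitRows g) * D 1ᴹ  ∎
      where
      unitRows≈1ᴹ : unitRows g ≈ 1ᴹ
      unitRows≈1ᴹ i j = cong (λ r → δ r j) (g≗id i)

    collision-case : ∀ g {j₁ j₂} → j₁ ≢ j₂ → g j₁ ≡ g j₂ → Claim g
    collision-case g j₁≢j₂ gj₁≡gj₂ = trans (D-alternating _ _ _ j₁≢j₂ equal-rows)
      (sym (cong (_* D 1ᴹ) (det-alternating _ _ _ j₁≢j₂ equal-rows)))
      where
      equal-rows : unitRows g _ ≗ unitRows g _
      equal-rows c = cong (λ r → δ r c) gj₁≡gj₂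

    swap-case : ∀ g {i k} → i ≢ k → Claim (g ∘ τ i k) → Claim g
    swap-case g {i} {k} i≢k claim = ℤₚ.neg-injective (begin
      - D (unitRows g)                  ≡⟨ swapRows-negates D-multilinear i≢k
                                              (λ A → D-alternating A i k i≢k) (unitRows g) ⟨
      D (unitRows g ∘ τ i k)            ≡⟨ claim ⟩
      det (unitRows g ∘ τ i k) * D 1ᴹ   ≡⟨ cong (_* D 1ᴹ) (swapRows-negates det-multilinear i≢k
                                              (λ A → det-alternating A i k i≢k) (unitRows g)) ⟩
      - det (unitRows g) * D 1ᴹ         ≡⟨ ℤₚ.neg-distribˡ-* (det (unitRows g)) (D 1ᴹ) ⟨
      - (det (unitRows g) * D 1ᴹ)       ∎)

    extend-fixed : ∀ {i : Fin n} (h : Fin n → Fin n) → (∀ j → toℕ j ℕ.< toℕ (inject₁ i) → h j ≡ j) → h i ≡ i →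
                   ∀ j → toℕ j ℕ.< toℕ (suc i) → h j ≡ j
    extend-fixed {i} h fixed hi≡i j j≤i with ℕₚ.m≤n⇒m<n∨m≡n (ℕₚ.≤-pred j≤i)
    ... | inj₁ j<i = fixed j (subst (toℕ j ℕ.<_) (sym (Finₚ.toℕ-inject₁ i)) j<i)
    ... | inj₂ j≡i = subst (λ x → h x ≡ x) (sym (Finₚ.toℕ-injective j≡i)) hi≡i

    fix-next : ∀ i → FixedBelow (suc i) → FixedBelow (inject₁ i)
    fix-next i IH g fixed with Finₚ.any? (λ k → g k Finₚ.≟ i)
    ... | no ∄k with j₁ , j₂ , j₁≢j₂ , collision ← missing-value-collision g (λ k gk≡i → ∄k (k , gk≡i)) =
      collision-case g j₁≢j₂ collision
    ... | yes (k , gk≡i) with k Finₚ.≟ i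
    ...   | yes refl = IH g (extend-fixed g fixed gk≡i)
    ...   | no k≢i   = swap-case g (k≢i ∘ sym) (IH (g ∘ τ i k) (extend-fixed (g ∘ τ i k) fixed′ gτi≡i))
      where
      gτi≡i : g (τ i k i) ≡ i
      gτi≡i = trans (cong g (transpose-matchˡ i k)) gk≡i
      fixed′ : ∀ j → toℕ j ℕ.< toℕ (inject₁ i) → g (τ i k j) ≡ j
      fixed′ j j<i = trans (cong g (transpose-mismatch j≢i j≢k)) (fixed j j<i)
        where
        j≢i : j ≢ i
        j≢i j≡i = ℕₚ.<-irrefl (trans (cong toℕ j≡i) (sym (Finₚ.toℕ-inject₁ i))) j<i
        j≢k : j ≢ k
        j≢k refl = j≢i (trans (sym (fixed j j<i)) gk≡i)

  unitRows-unique : ∀ g → D (unitRows g) ≡ det (unitRows g) * D 1ᴹ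
  unitRows-unique g = >-weakInduction FixedBelow all-fixed fix-next zero g (λ _ ())
    where
    all-fixed : FixedBelow (fromℕ n)
    all-fixed g fixed = identity-case g λ j →
      fixed j (subst (toℕ j ℕ.<_) (sym (Finₚ.toℕ-fromℕ n)) (Finₚ.toℕ<n j))

  det-unique : ∀ A → D A ≡ det A * D 1ᴹ
  det-unique A = begin
    D A                             ≡⟨ multilinear-expansion D-multilinear A ⟩
    sumMaps (λ g → P g * D (U g))   ≡⟨ sumMaps-cong (λ g → trans (cong (P g *_) (unitRows-unique g))
                                                                (sym (ℤₚ.*-assoc (P g) _ _))) ⟩
    sumMaps (λ g → P g * det (U g) * D 1ᴹ)  ≡⟨ *-distribʳ-sumMaps (D 1ᴹ) (λ g → P g * det (U g)) ⟨
    sumMaps (λ g → P g * det (U g)) * D 1ᴹ  ≡⟨ cong (_* D 1ᴹ) (multilinear-expansion det-multilinear A) ⟨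
    det A * D 1ᴹ                            ∎
    where
    P = entryProduct A
    U = unitRows

-- Permuting the columns gives another alternating multilinear function of the rows, so by uniqueness the
-- sign is read off at the identity matrix.
det-swapColumns : ∀ {p q : Fin n} → p ≢ q → ∀ (A : Matrix n n) → det (λ i → A i ∘ τ p q) ≡ - det A
det-swapColumns {n} {p} {q} p≢q A = begin
  D A            ≡⟨ det-unique D-multilinear D-alternating A ⟩
  det A * D 1ᴹ   ≡⟨ cong (det A *_) D-1ᴹ ⟩
  det A * -1ℤ    ≡⟨ trans (ℤₚ.*-comm (det A) -1ℤ) (ℤₚ.-1*i≡-i (det A)) ⟩
  - det A        ∎
  where
  D : Matrix n n → ℤ
  D B = det (λ i → B i ∘ τ p q)

  D-multilinear : IsMultilinear D
  D-multilinear = record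
    { cong-≈ = λ B≈C → det-cong λ i j → B≈C i (τ p q j)
    ; linear = λ r a b B C E B~C B~E Br → det-linear r a b _ _ _
        (λ i i≢r j → B~C i i≢r (τ p q j)) (λ i i≢r j → B~E i i≢r (τ p q j)) (λ j → Br (τ p q j))
    }

  D-alternating : Alternating D
  D-alternating B r s r≢s Br≗Bs = det-alternating _ r s r≢s λ j → Br≗Bs (τ p q j)

  D-1ᴹ : D 1ᴹ ≡ -1ℤ
  D-1ᴹ = begin
    det (λ i j → δ i (τ p q j))  ≡⟨ det-cong (δ-transpose p q) ⟩
    det (1ᴹ ∘ τ p q)             ≡⟨ swapRows-negates (det-multilinear {n}) p≢q (λ B → det-alternating B p q p≢q) 1ᴹ ⟩
    - det (1ᴹ {n})               ≡⟨ cong -_ (det-1ᴹ {n}) ⟩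
    -1ℤ                          ∎

det-alternatingᶜ : Alternating (λ (A : Matrix n n) → det (transpose A))
det-alternatingᶜ A p q p≢q Ap≗Aq = self-negative⇒zero (begin
  det (transpose A)                  ≡⟨ det-cong (λ i → transpose-invariance (λ r → A r i) (Ap≗Aq i)) ⟨
  det (λ i → transpose A i ∘ τ p q)  ≡⟨ det-swapColumns p≢q (transpose A) ⟩
  - det (transpose A)                ∎)

det-transpose : ∀ (A : Matrix n n) → det (transpose A) ≡ det A
det-transpose {n} A = begin
  det (transpose A)                 ≡⟨ det-unique {n} detᵀ-multilinear det-alternatingᶜ A ⟩
  det A * det (transpose (1ᴹ {n}))  ≡⟨ cong (det A *_) (trans (det-cong {n} λ i j → δ-sym j i) (det-1ᴹ {n})) ⟩
  det A * 1ℤ                        ≡⟨ ℤₚ.*-identityʳ (det A) ⟩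
  det A                             ∎
  where
  detᵀ-multilinear : IsMultilinear (λ (B : Matrix n n) → det (transpose B))
  detᵀ-multilinear = record { cong-≈ = λ B≈C → det-cong λ i j → B≈C j i ; linear = det-linearᶜ }

dot-congˡ : ∀ {u v : ℤVec n} → u ≗ v → ∀ w → dot u w ≡ dot v w
dot-congˡ u≗v w = sum-cong-≗ λ c → cong (_* w c) (u≗v c)

det-*ᵀ : ∀ (A B : Matrix n n) → det (λ i j → dot (A i) (B j)) ≡ det A * det B
det-*ᵀ {n} A B = begin
  D A             ≡⟨ det-unique D-multilinear D-alternating A ⟩
  det A * D 1ᴹ    ≡⟨ cong (det A *_) (trans (det-cong λ i j → dot-δˡ i (B j)) (det-transpose B)) ⟩
  det A * det B   ∎
  where
  D : Matrix n n → ℤ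
  D X = det (λ i j → dot (X i) (B j))

  D-multilinear : IsMultilinear D
  D-multilinear = record
    { cong-≈ = λ X≈Y → det-cong λ i j → dot-congˡ (X≈Y i) (B j)
    ; linear = λ p a b X Y Z X~Y X~Z Xp → det-linear p a b _ _ _
        (λ i i≢p j → dot-congˡ (X~Y i i≢p) (B j)) (λ i i≢p j → dot-congˡ (X~Z i i≢p) (B j))
        (λ j → dot-linearˡ a b (B j) Xp)
    }

  D-alternating : Alternating D
  D-alternating X p q p≢q Xp≗Xq = det-alternating _ p q p≢q λ j → dot-congˡ Xp≗Xq (B j)

square-nonneg : ∀ x → 0ℤ ℤ.≤ x * x
square-nonneg (ℤ.+ n)    = subst (0ℤ ℤ.≤_) (ℤₚ.pos-* n n) (ℤ.+≤+ ℕ.z≤n)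
square-nonneg ℤ.-[1+ n ] = ℤ.+≤+ ℕ.z≤n

dot-self-nonneg : ∀ (v : ℤVec n) → 0ℤ ℤ.≤ dot v v
dot-self-nonneg {zero}  v = ℤₚ.≤-refl
dot-self-nonneg {suc n} v = ℤₚ.+-mono-≤ (square-nonneg (v zero)) (dot-self-nonneg (tail v))

coprime-square-ratio : ∀ {a d b} → Coprime b a → a ℕ.* a ≡ d ℕ.* (b ℕ.* b) → b ≡ 1
coprime-square-ratio {a} {d} {b} b⊥a a²≡db² =
  b⊥a (∣-refl , coprime-divisor b⊥a (divides (d ℕ.* b) (trans a²≡db² (sym (ℕₚ.*-assoc d b b)))))

square-ratio⇒square : ∀ a d b → b ≢ 0 → a ℕ.* a ≡ d ℕ.* (b ℕ.* b) → ∃ λ c → c ℕ.* c ≡ d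
square-ratio⇒square a d b b≢0 a²≡db² = a′ , (begin
  a′ ℕ.* a′            ≡⟨ reduced ⟩
  d ℕ.* (b′ ℕ.* b′)    ≡⟨ cong (λ x → d ℕ.* (x ℕ.* x))
                              (coprime-square-ratio {a′} {d} {b′} (coprime-sym (coprime-/gcd a b)) reduced) ⟩
  d ℕ.* 1              ≡⟨ ℕₚ.*-identityʳ d ⟩
  d                    ∎)
  where
  g = gcd a b
  instance
    g≢0 : ℕ.NonZero g
    g≢0 = ℕ.≢-nonZero λ g≡0 → b≢0 (0∣⇒≡0 (subst (_∣ b) g≡0 (gcd[m,n]∣n a b)))
    g²≢0 : ℕ.NonZero (g ℕ.* g)
    g²≢0 = ℕₚ.m*n≢0 g g
  a′ = a / g
  b′ = b / g
  reduced : a′ ℕ.* a′ ≡ d ℕ.* (b′ ℕ.* b′)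
  reduced = ℕₚ.*-cancelʳ-≡ _ _ (g ℕ.* g) (begin
    a′ ℕ.* a′ ℕ.* (g ℕ.* g)                 ≡⟨ regroup a′ g ⟩
    (a′ ℕ.* g) ℕ.* (a′ ℕ.* g)               ≡⟨ cong₂ ℕ._*_ a′g≡a a′g≡a ⟩
    a ℕ.* a                                 ≡⟨ a²≡db² ⟩
    d ℕ.* (b ℕ.* b)                         ≡⟨ cong₂ (λ x y → d ℕ.* (x ℕ.* y)) b′g≡b b′g≡b ⟨
    d ℕ.* ((b′ ℕ.* g) ℕ.* (b′ ℕ.* g))       ≡⟨ cong (d ℕ.*_) (regroup b′ g) ⟨
    d ℕ.* (b′ ℕ.* b′ ℕ.* (g ℕ.* g))         ≡⟨ ℕₚ.*-assoc d (b′ ℕ.* b′) (g ℕ.* g) ⟨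
    d ℕ.* (b′ ℕ.* b′) ℕ.* (g ℕ.* g)         ∎)
    where
    a′g≡a : a′ ℕ.* g ≡ a
    a′g≡a = m/n*n≡m (gcd[m,n]∣m a b)
    b′g≡b : b′ ℕ.* g ≡ b
    b′g≡b = m/n*n≡m (gcd[m,n]∣n a b)
    regroup : ∀ x y → x ℕ.* x ℕ.* (y ℕ.* y) ≡ (x ℕ.* y) ℕ.* (x ℕ.* y)
    regroup = ℕ-Solver.solve-∀

ℤ-square-ratio⇒square : ∀ {a d b : ℤ} → 0ℤ ℤ.≤ d → (b ≡ 0ℤ → d ≡ 0ℤ) → a * a ≡ d * (b * b) → ∃ λ l → l * l ≡ d
ℤ-square-ratio⇒square {a} {d} {b} 0≤d b≡0⇒d≡0 a²≡db² with b ℤ.≟ 0ℤ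
... | yes b≡0 = 0ℤ , sym (b≡0⇒d≡0 b≡0)
... | no b≢0 = from-ℕ (square-ratio⇒square ℤ.∣ a ∣ ℤ.∣ d ∣ ℤ.∣ b ∣ (b≢0 ∘ ℤₚ.∣i∣≡0⇒i≡0) ∣a∣²≡∣d∣∣b∣²)
  where
  from-ℕ : (∃ λ c → c ℕ.* c ≡ ℤ.∣ d ∣) → ∃ λ l → l * l ≡ d
  from-ℕ (c , c²≡∣d∣) = ℤ.+ c , (begin
    ℤ.+ c * ℤ.+ c     ≡⟨ ℤₚ.pos-* c c ⟨
    ℤ.+ (c ℕ.* c)     ≡⟨ cong ℤ.+_ c²≡∣d∣ ⟩
    ℤ.+ ℤ.∣ d ∣        ≡⟨ ℤₚ.0≤i⇒+∣i∣≡i 0≤d ⟩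
    d                 ∎)

  ∣a∣²≡∣d∣∣b∣² : ℤ.∣ a ∣ ℕ.* ℤ.∣ a ∣ ≡ ℤ.∣ d ∣ ℕ.* (ℤ.∣ b ∣ ℕ.* ℤ.∣ b ∣)
  ∣a∣²≡∣d∣∣b∣² = begin
    ℤ.∣ a ∣ ℕ.* ℤ.∣ a ∣               ≡⟨ ℤₚ.abs-* a a ⟨
    ℤ.∣ a * a ∣                       ≡⟨ cong ℤ.∣_∣ a²≡db² ⟩
    ℤ.∣ d * (b * b) ∣                 ≡⟨ ℤₚ.abs-* d (b * b) ⟩
    ℤ.∣ d ∣ ℕ.* ℤ.∣ b * b ∣           ≡⟨ cong (ℤ.∣ d ∣ ℕ.*_) (ℤₚ.abs-* b b) ⟩
    ℤ.∣ d ∣ ℕ.* (ℤ.∣ b ∣ ℕ.* ℤ.∣ b ∣)  ∎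

product-const : ∀ n x → product {n} (λ _ → x) ≡ x ^ n
product-const zero    x = refl
product-const (suc n) x = cong (x *_) (product-const n x)

odd-power : ∀ x m → x ^ suc (2 ℕ.* m) ≡ x * (x ^ m * x ^ m)
odd-power x m = cong (x *_)
  (trans (ℤₚ.^-distribˡ-+-* x m (m ℕ.+ 0)) (cong (λ e → x ^ m * x ^ e) (ℕₚ.+-identityʳ m)))

proposition1p1 : (m : ℕ) → (v : Fin (suc (2 ℕ.* m)) → ℤVec (suc (2 ℕ.* m))) →
    IsICube (suc (2 ℕ.* m)) (suc (2 ℕ.* m)) v → EdgeLengthIsInteger v
proposition1p1 m v icube =
  ℤ-square-ratio⇒square {det v} {d} {d ^ m} (dot-self-nonneg (v zero)) (ℤₚ.i^n≡0⇒i≡0 d m) det²≡d[dᵐ]²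
  where
  open IsICube icube
  N : ℕ
  N = suc (2 ℕ.* m)

  d : ℤ
  d = dot (v zero) (v zero)

  gram : ∀ i j → dot (v i) (v j) ≡ d * δ i j
  gram i j with i Finₚ.≟ j
  ... | yes refl = trans (sameLength i zero) (sym (trans (cong (d *_) (δ-diag i)) (ℤₚ.*-identityʳ d)))
  ... | no i≢j   = trans (orthogonal i j i≢j) (sym (trans (cong (d *_) (δ-offdiag i≢j)) (ℤₚ.*-zeroʳ d)))

  det²≡d[dᵐ]² : det v * det v ≡ d * (d ^ m * d ^ m)
  det²≡d[dᵐ]² = begin
    det v * det v                   ≡⟨ det-*ᵀ v v ⟨
    det (λ i j → dot (v i) (v j))   ≡⟨ det-cong gram ⟩
    det {N} (λ i j → d * δ i j)     ≡⟨ det-diagonal {N} (λ _ → d) ⟩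
    product {N} (λ _ → d)           ≡⟨ product-const N d ⟩
    d ^ N                           ≡⟨ odd-power d m ⟩
    d * (d ^ m * d ^ m)             ∎
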